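{- For any formulas $\phi$ and $\psi$ in the language of $\mathbf{CPL}^+$: if $\phi\models\psi$ then $\phi\vdash\psi$ in the natural deduction system of $\mathbf{CPL}^+$.
   Context: Formulas of $\mathbf{CPL}^+$: $\phi::=p_i\mid\neg p_i\mid\bot\mid\mathrm{NE}\mid\phi\wedge\phi\mid\phi\otimes\phi$. A valuation on $N\subseteq\mathbb N$ is $s:N\to\{0,1\}$, a team on $N$ a set of such (a team: on $\mathbb N$). Semantics: $X\models p_i$ iff $s(i)=1$ for all $s\in X$; $X\models\neg p_i$ iff $s(i)=0$ for all $s\in X$; $X\models\bot$ iff $X=\emptyset$; $X\models\mathrm{NE}$ iff $X\neq\emptyset$; $\wedge$ as usual; $X\models\phi\otimes\psi$ iff $X=Y\cup Z$ for some $Y,Z\subseteq X$ with $Y\models\phi$, $Z\models\psi$. $\phi\models\psi$: every team satisfying $\phi$ satisfies $\psi$. Classical formulas: those without $\mathrm{NE}$. $p_i^1=p_i$, $p_i^0=\neg p_i$; empty $\otimes$-disjunction is $\bot$; for a team $X$ on finite $N=\{i_1,\dots,i_n\}$, $\Theta^*_X=\bigotimes_{s\in X}(p_{i_1}^{s(i_1)}\wedge\dots\wedge p_{i_n}^{s(i_n)}\wedge\mathrm{NE})$. A formula is viewed as a string of symbols numbered from the left starting at 1; $[\psi,m]$ denotes the occurrence of the subformula $\psi$ beginning at the $m$-th symbol, and $\phi(\beta/[\psi,m])$ the result of replacing that occurrence by $\beta$. Natural deduction system of $\mathbf{CPL}^+$ ($\Gamma\vdash\phi$ iff some derivation of $\phi$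 has undischarged assumptions in $\Gamma$; metavariables range over all formulas, axioms are specific formulas, no substitution rule). Axiom: $p_i\otimes\neg p_i$ (each $i$). Rules: standard $\wedge$-introduction/elimination; from $\phi$ infer $\phi\otimes\psi$ if $\psi$ does not contain $\mathrm{NE}$; from $\phi$ infer $\phi\otimes\phi$; from $\phi\otimes\psi$, a derivation of $\alpha$ from $\phi$ and one from $\psi$, infer $\alpha$ (discharging $\phi,\psi$), provided $\alpha$ is classical and the other undischarged assumptions of both subderivations are classical; from $\phi\otimes\psi$ and a derivation of $\chi$ from $\psi$ (discharged) infer $\phi\otimes\chi$, provided the other undischarged assumptions of that subderivation are classical; from $\phi\otimes\psi$ infer $\psi\otimes\phi$; from $\phi\otimes(\psi\otimes\chi)$ infer $(\phi\otimes\psi)\otimes\chi$; from $p_i\wedge\neg p_i$ infer $\bot$; from $\phi\otimes\bot$ infer $\phi$; from $\bot\wedge\mathrm{NE}$ infer any $\phi$; from $\phi\otimes(\bot\wedge\mathrm{NE})$ infer $\bot\wedge\mathrm{NE}$; from $\Theta^*_X\wedge\Theta^*_Y$ infer $\bot\wedge\mathrm{NE}$ for distinct teams $X,Y$ on the same finite index set; from $\alpha\wedge(\psi\otimes\chi)$ infer $(\alpha\wedge\psi)\otimes(\alpha\wedge\chi)$ for classical $\alpha$; Strong elimination 1: given a finite index set $N$ with $Y_1,\dots,Y_k$ all nonempty teams on $N$, and an occurrence $[\mathrm{NE},m]$ in $\phi$: from $\phi$ and derivations of $\theta$ from each $\phi(\Theta^*_{Y_j}/[\mathrm{NE},m])$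 (discharged), infer $\theta$; Strong elimination 2: for an occurrence $[\psi,m]$ of a subformula of $\phi$: from $\phi$, a derivation of $\theta$ from $\phi(\psi\wedge\bot/[\psi,m])$ and one from $\phi(\psi\wedge\mathrm{NE}/[\psi,m])$ (discharged), infer $\theta$. -}

module Defs where

open import Data.Nat using (ℕ; zero; suc)
open import Data.Bool using (Bool; true; false)
open import Data.List using (List; []; _∷_; length; map; filter; _++_)
open import Data.List.Membership.Propositional using (_∈_)
open import Data.List.Relation.Unary.Unique.Propositional using (Unique)
open import Data.Vec using (Vec; []; _∷_)
open import Data.Product using (Σ; _×_; ∃; _,_)
open import Data.Sum using (_⊎_)
open import Data.Unit using (⊤)
open import Data.Empty renaming (⊥ to Empty)
open import Relation.Nullary using (¬_)
open import Relation.Binary.PropositionalEquality using (_≡_; _≢_)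
import Level
import Data.Bool

infixr 6 _∧f_
infixr 5 _⊗_

data Fm : Set where
  P    : ℕ → Fm
  ¬P   : ℕ → Fm
  ⊥f   : Fm
  NE   : Fm
  _∧f_ : Fm → Fm → Fm
  _⊗_  : Fm → Fm → Fm

Classical : Fm → Set
Classical (P _)    = ⊤
Classical (¬P _)   = ⊤
Classical ⊥f       = ⊤
Classical NE       = Empty
Classical (φ ∧f ψ) = Classical φ × Classical ψ
Classical (φ ⊗ ψ)  = Classical φ × Classical ψ

Valuation : Set
Valuation = ℕ → Bool

Team : Set₁
Team = Valuation → Set

_⊆T_ : Team → Team → Set
Y ⊆T X = ∀ s → Y s → X s

IsUnion : Team → Team → Team → Set
IsUnion X Y Z = Y ⊆T X × Z ⊆T X × (∀ s → X s → Y s ⊎ Z s)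

_⊨ₜ_ : Team → Fm → Set₁
X ⊨ₜ P i    = Level.Lift (Level.suc Level.zero) (∀ s → X s → s i ≡ true)
X ⊨ₜ ¬P i   = Level.Lift (Level.suc Level.zero) (∀ s → X s → s i ≡ false)
X ⊨ₜ ⊥f     = Level.Lift (Level.suc Level.zero) (∀ s → ¬ X s)
X ⊨ₜ NE     = Level.Lift (Level.suc Level.zero) (∃ λ s → X s)
X ⊨ₜ (φ ∧f ψ) = X ⊨ₜ φ × X ⊨ₜ ψ
X ⊨ₜ (φ ⊗ ψ)  = Σ Team λ Y → Σ Team λ Z →
                  Level.Lift (Level.suc Level.zero) (IsUnion X Y Z) × Y ⊨ₜ φ × Z ⊨ₜ ψ

_⊨_ : Fm → Fm → Set₁
φ ⊨ ψ = ∀ (X : Team) → X ⊨ₜ φ → X ⊨ₜ ψ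

-- N is given as a duplicate-free list [i₁,…,iₙ]; a valuation on N is a
-- Vec Bool n (s(i_k) = k-th entry); a team on N is a decidable set of
-- such valuations, i.e. a function Vec Bool n → Bool.

lit : ℕ → Bool → Fm
lit i true  = P i
lit i false = ¬P i

conjNE : (N : List ℕ) → Vec Bool (length N) → Fm
conjNE []      []      = NE
conjNE (i ∷ N) (b ∷ v) = lit i b ∧f conjNE N v

allVals : (n : ℕ) → List (Vec Bool n)
allVals zero    = [] ∷ []
allVals (suc n) = map (false ∷_) (allVals n) ++ map (true ∷_) (allVals n)

bigO : List Fm → Fm
bigO []           = ⊥f
bigO (φ ∷ [])     = φ
bigO (φ ∷ ψ ∷ φs) = φ ⊗ bigO (ψ ∷ φs)

TeamOn : List ℕ → Set
TeamOn N = Vec Bool (length N) → Bool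

Θ* : (N : List ℕ) → TeamOn N → Fm
Θ* N X = bigO (map (conjNE N) (filter (λ v → Data.Bool._≟_ (X v) true) (allVals (length N))))

NonEmptyTeam : (N : List ℕ) → TeamOn N → Set
NonEmptyTeam N X = ∃ λ v → X v ≡ true

DistinctTeams : (N : List ℕ) → TeamOn N → TeamOn N → Set
DistinctTeams N X Y = ∃ λ v → X v ≢ Y v

-- Occurrences of subformulas (as positions in the syntax tree, which
-- correspond one-to-one with the occurrences [ψ,m] in the string) and
-- replacement φ(β/[ψ,m]).

data Pos : Fm → Set where
  here : ∀ {φ} → Pos φ
  ∧l   : ∀ {φ ψ} → Pos φ → Pos (φ ∧f ψ)
  ∧r   : ∀ {φ ψ} → Pos ψ → Pos (φ ∧f ψ)
  ⊗l   : ∀ {φ ψ} → Pos φ → Pos (φ ⊗ ψ)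
  ⊗r   : ∀ {φ ψ} → Pos ψ → Pos (φ ⊗ ψ)

subAt : (φ : Fm) → Pos φ → Fm
subAt φ here = φ
subAt (φ ∧f ψ) (∧l p) = subAt φ p
subAt (φ ∧f ψ) (∧r p) = subAt ψ p
subAt (φ ⊗ ψ) (⊗l p) = subAt φ p
subAt (φ ⊗ ψ) (⊗r p) = subAt ψ p

replaceAt : (φ : Fm) → Pos φ → Fm → Fm
replaceAt φ here β = β
replaceAt (φ ∧f ψ) (∧l p) β = replaceAt φ p β ∧f ψ
replaceAt (φ ∧f ψ) (∧r p) β = φ ∧f replaceAt ψ p β
replaceAt (φ ⊗ ψ) (⊗l p) β = replaceAt φ p β ⊗ ψ
replaceAt (φ ⊗ ψ) (⊗r p) β = φ ⊗ replaceAt ψ p β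

-- Discharged assumptions are added to the context
-- of the subderivation. For rules with the side condition "the other
-- undischarged assumptions are classical", the subderivation's other
-- assumptions are an explicit list Δ ⊆ Γ of classical formulas.

_⊆L_ : List Fm → List Fm → Set
Δ ⊆L Γ = ∀ {φ} → φ ∈ Δ → φ ∈ Γ

AllClassical : List Fm → Set
AllClassical Δ = ∀ {φ} → φ ∈ Δ → Classical φ

infix 3 _⊢_

data _⊢_ (Γ : List Fm) : Fm → Set where
  assume : ∀ {φ} → φ ∈ Γ → Γ ⊢ φ
  ax     : ∀ i → Γ ⊢ P i ⊗ ¬P i
  ∧I     : ∀ {φ ψ} → Γ ⊢ φ → Γ ⊢ ψ → Γ ⊢ φ ∧f ψ
  ∧E₁    : ∀ {φ ψ} → Γ ⊢ φ ∧f ψ → Γ ⊢ φ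
  ∧E₂    : ∀ {φ ψ} → Γ ⊢ φ ∧f ψ → Γ ⊢ ψ
  ⊗I     : ∀ {φ ψ} → Classical ψ → Γ ⊢ φ → Γ ⊢ φ ⊗ ψ
  ⊗dup   : ∀ {φ} → Γ ⊢ φ → Γ ⊢ φ ⊗ φ
  ⊗E     : ∀ {φ ψ α} (Δ₁ Δ₂ : List Fm) →
           Classical α → AllClassical Δ₁ → AllClassical Δ₂ →
           Δ₁ ⊆L Γ → Δ₂ ⊆L Γ →
           Γ ⊢ φ ⊗ ψ → (φ ∷ Δ₁) ⊢ α → (ψ ∷ Δ₂) ⊢ α → Γ ⊢ α
  ⊗Sub   : ∀ {φ ψ χ} (Δ : List Fm) → AllClassical Δ → Δ ⊆L Γ →
           Γ ⊢ φ ⊗ ψ → (ψ ∷ Δ) ⊢ χ → Γ ⊢ φ ⊗ χ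
  ⊗Comm  : ∀ {φ ψ} → Γ ⊢ φ ⊗ ψ → Γ ⊢ ψ ⊗ φ
  ⊗Ass   : ∀ {φ ψ χ} → Γ ⊢ φ ⊗ (ψ ⊗ χ) → Γ ⊢ (φ ⊗ ψ) ⊗ χ
  contr  : ∀ {i} → Γ ⊢ P i ∧f ¬P i → Γ ⊢ ⊥f
  ⊗⊥     : ∀ {φ} → Γ ⊢ φ ⊗ ⊥f → Γ ⊢ φ
  exFalso : ∀ {φ} → Γ ⊢ ⊥f ∧f NE → Γ ⊢ φ
  ⊗⊥NE   : ∀ {φ} → Γ ⊢ φ ⊗ (⊥f ∧f NE) → Γ ⊢ ⊥f ∧f NE
  ΘE     : ∀ (N : List ℕ) → Unique N → (X Y : TeamOn N) →
           DistinctTeams N X Y →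
           Γ ⊢ Θ* N X ∧f Θ* N Y → Γ ⊢ ⊥f ∧f NE
  distr  : ∀ {α ψ χ} → Classical α →
           Γ ⊢ α ∧f (ψ ⊗ χ) → Γ ⊢ (α ∧f ψ) ⊗ (α ∧f χ)
  SE₁    : ∀ {φ θ} (N : List ℕ) → Unique N → (m : Pos φ) → subAt φ m ≡ NE →
           Γ ⊢ φ →
           (∀ (Y : TeamOn N) → NonEmptyTeam N Y → (replaceAt φ m (Θ* N Y) ∷ Γ) ⊢ θ) →
           Γ ⊢ θ
  SE₂    : ∀ {φ θ} (m : Pos φ) → Γ ⊢ φ →
           (replaceAt φ m (subAt φ m ∧f ⊥f) ∷ Γ) ⊢ θ →
           (replaceAt φ m (subAt φ m ∧f NE) ∷ Γ) ⊢ θ →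
           Γ ⊢ θ

-- Fix a duplicate-free list N containing the variables of φ and ψ. A finite team on N, listed as the
-- leaves of a tree t, has the characteristic formula Θ t: the ⊗ of the formulas conjNE N v over its
-- members v. Strong elimination (SE₂, then SE₁ on the NE it introduces) turns φ into a case split over
-- all t, with φ ∧ Θ t as hypothesis. For every χ over N, Θ t ⊢ χ when the team satisfies χ, and
-- χ, Θ t ⊢ ⊥ ∧ NE when it does not. The latter closes the cases where the team fails φ; in the others
-- the team satisfies ψ because φ ⊨ ψ, so Θ t ⊢ ψ.

module Submission where

open import Defs

open import Data.Bool using (Bool; true; false)
import Data.Bool as Bool
open import Data.Empty using (⊥-elim)
open import Data.List using (List; []; _∷_; length; map; filter; _++_; deduplicate)
open import Data.List.Membership.Propositional using (_∈_; _∉_; find)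
open import Data.List.Membership.Propositional.Properties using (∈-++⁻; ∈-++⁺ˡ; ∈-++⁺ʳ; ∈-deduplicate⁺)
open import Data.List.Properties using (++-conicalˡ; ++-conicalʳ)
open import Data.List.Relation.Binary.Subset.Propositional using (_⊆_)
open import Data.List.Relation.Binary.Subset.Propositional.Properties using (⊆[]⇒≡[]; ∷⁺ʳ; ∈-∷⁺ʳ)
open import Data.List.Relation.Unary.All as All using (All; []; _∷_)
open import Data.List.Relation.Unary.All.Properties using (¬All⇒Any¬)
import Data.List.Relation.Unary.All.Properties as All
open import Data.List.Relation.Unary.Any using (here; there)
open import Data.List.Relation.Unary.Unique.Propositional using (Unique)
import Data.List.Relation.Unary.AllPairs as AllPairs
open import Data.Nat using (ℕ; _≟_)
open import Data.List.Relation.Unary.Unique.DecPropositional.Properties _≟_ using (deduplicate-!)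
open import Data.Product using (∃; ∃₂; _×_; _,_; proj₁; proj₂)
open import Data.Sum using (_⊎_; inj₁; inj₂)
import Data.Sum as Sum
open import Data.Unit using (⊤; tt)
open import Data.Vec using (Vec; []; _∷_)
import Data.Vec.Properties as Vec
open import Effect.Monad using (RawMonad)
open import Function using (_∘_; id; case_of_)
open import Level using (lift)
open import Relation.Binary.PropositionalEquality using (_≡_; _≢_; refl; sym; trans; cong; cong₂; subst)
open import Relation.Nullary using (¬_; Dec; yes; no)
open import Relation.Nullary.Decidable using (map′; _×-dec_; _⊎-dec_; decidable-stable; ¬¬-excluded-middle)
open import Relation.Nullary.Negation using (¬¬-Monad)

open RawMonad (¬¬-Monad {Level.zero}) using (_>>=_; pure)

variable
  Γ Δ : List Fm
  φ φ′ ψ ψ′ χ θ α : Fm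

hyp : (φ ∷ Γ) ⊢ φ
hyp = assume (here refl)

-- Unlike ⊥, which holds in the empty team, ⊥⁺ is satisfied by no team.
⊥⁺ : Fm
⊥⁺ = ⊥f ∧f NE

infix 2 _⟹_
_⟹_ : Fm → Fm → Set
φ ⟹ ψ = ∀ {Γ} → Γ ⊢ φ → Γ ⊢ ψ

∷⁺ : Γ ⊆L Δ → (φ ∷ Γ) ⊆L (φ ∷ Δ)
∷⁺ Γ⊆Δ (here eq)  = here eq
∷⁺ Γ⊆Δ (there φ∈) = there (Γ⊆Δ φ∈)

weaken : Γ ⊆L Δ → Γ ⊢ φ → Δ ⊢ φ
weaken s (assume φ∈) = assume (s φ∈)
weaken s (ax i) = ax i
weaken s (∧I d e) = ∧I (weaken s d) (weaken s e)
weaken s (∧E₁ d) = ∧E₁ (weaken s d)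
weaken s (∧E₂ d) = ∧E₂ (weaken s d)
weaken s (⊗I c d) = ⊗I c (weaken s d)
weaken s (⊗dup d) = ⊗dup (weaken s d)
weaken s (⊗E Δ₁ Δ₂ c c₁ c₂ s₁ s₂ d e₁ e₂) =
  ⊗E Δ₁ Δ₂ c c₁ c₂ (λ φ∈ → s (s₁ φ∈)) (λ φ∈ → s (s₂ φ∈)) (weaken s d) e₁ e₂
weaken s (⊗Sub Δ c s₁ d e) = ⊗Sub Δ c (λ φ∈ → s (s₁ φ∈)) (weaken s d) e
weaken s (⊗Comm d) = ⊗Comm (weaken s d)
weaken s (⊗Ass d) = ⊗Ass (weaken s d)
weaken s (contr d) = contr (weaken s d)
weaken s (⊗⊥ d) = ⊗⊥ (weaken s d)
weaken s (exFalso d) = exFalso (weaken s d)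
weaken s (⊗⊥NE d) = ⊗⊥NE (weaken s d)
weaken s (ΘE N u X Y X≠Y d) = ΘE N u X Y X≠Y (weaken s d)
weaken s (distr c d) = distr c (weaken s d)
weaken s (SE₁ N u m m≡NE d e) = SE₁ N u m m≡NE (weaken s d) (λ Y Y≠∅ → weaken (∷⁺ s) (e Y Y≠∅))
weaken s (SE₂ m d e₁ e₂) = SE₂ m (weaken s d) (weaken (∷⁺ s) e₁) (weaken (∷⁺ s) e₂)

⊗-mapʳ : Γ ⊢ φ ⊗ ψ → ψ ⟹ χ → Γ ⊢ φ ⊗ χ
⊗-mapʳ d f = ⊗Sub [] (λ ()) (λ ()) d (f hyp)

⊗-mapˡ : Γ ⊢ φ ⊗ ψ → φ ⟹ χ → Γ ⊢ χ ⊗ ψ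
⊗-mapˡ d f = ⊗Comm (⊗-mapʳ (⊗Comm d) f)

⊗-map : Γ ⊢ φ ⊗ ψ → φ ⟹ φ′ → ψ ⟹ ψ′ → Γ ⊢ φ′ ⊗ ψ′
⊗-map d f g = ⊗-mapʳ (⊗-mapˡ d f) g

⊗-elim : Classical α → Γ ⊢ φ ⊗ ψ → φ ⟹ α → ψ ⟹ α → Γ ⊢ α
⊗-elim c d f g = ⊗E [] [] c (λ ()) (λ ()) (λ ()) (λ ()) d (f hyp) (g hyp)

⊗-assocʳ : Γ ⊢ (φ ⊗ ψ) ⊗ χ → Γ ⊢ φ ⊗ (ψ ⊗ χ)
⊗-assocʳ d = ⊗Comm (⊗Ass (⊗Comm (⊗Ass (⊗Comm d))))

⊗-interchange : Γ ⊢ (φ ⊗ ψ) ⊗ (χ ⊗ θ) → Γ ⊢ (φ ⊗ χ) ⊗ (ψ ⊗ θ)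
⊗-interchange d = ⊗Ass (⊗-mapʳ (⊗-assocʳ d) λ e → ⊗-assocʳ (⊗-mapˡ (⊗Ass e) ⊗Comm))

⊗-absorbˡ : Γ ⊢ ⊥⁺ ⊗ φ → Γ ⊢ ⊥⁺
⊗-absorbˡ d = ⊗⊥NE (⊗Comm d)

⊥-elimᶜ : Classical α → Γ ⊢ ⊥f → Γ ⊢ α
⊥-elimᶜ c d = ⊗⊥ (⊗Comm (⊗I c d))

toValuation : (N : List ℕ) → Vec Bool (length N) → Valuation
toValuation []      []      i = false
toValuation (j ∷ N) (b ∷ v) i with i ≟ j
... | yes _ = b
... | no  _ = toValuation N v i

restrict : (N : List ℕ) → Valuation → Vec Bool (length N)
restrict []      s = []
restrict (i ∷ N) s = s i ∷ restrict N s

toValuation-restrict : ∀ N (s : Valuation) {i} → i ∈ N → toValuation N (restrict N s) i ≡ s i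
toValuation-restrict (j ∷ N) s {i} i∈ with i ≟ j | i∈
... | yes refl | _         = refl
... | no  i≢j  | here i≡j  = ⊥-elim (i≢j i≡j)
... | no  _    | there i∈N = toValuation-restrict N s i∈N

toValuation-head : ∀ N j b (v : Vec Bool (length N)) → toValuation (j ∷ N) (b ∷ v) j ≡ b
toValuation-head N j b v with j ≟ j
... | yes _   = refl
... | no  j≢j = ⊥-elim (j≢j refl)

toValuation-tail : ∀ N {i j} b (v : Vec Bool (length N)) → i ≢ j →
                   toValuation (j ∷ N) (b ∷ v) i ≡ toValuation N v i
toValuation-tail N {i} {j} b v i≢j with i ≟ j
... | yes i≡j = ⊥-elim (i≢j i≡j)
... | no  _   = refl

restrict-cong : ∀ N {s s′ : Valuation} → (∀ {i} → i ∈ N → s i ≡ s′ i) → restrict N s ≡ restrict N s′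
restrict-cong []      eq = refl
restrict-cong (i ∷ N) eq = cong₂ _∷_ (eq (here refl)) (restrict-cong N (eq ∘ there))

restrict-toValuation : ∀ {N} → Unique N → (v : Vec Bool (length N)) → restrict N (toValuation N v) ≡ v
restrict-toValuation {[]}    AllPairs.[]             []      = refl
restrict-toValuation {j ∷ N} (j∉N AllPairs.∷ unique) (b ∷ v) =
  cong₂ _∷_ (toValuation-head N j b v)
    (trans (restrict-cong N λ i∈N → toValuation-tail N b v (λ i≡j → All.lookup j∉N i∈N (sym i≡j)))
           (restrict-toValuation unique v))

lit-classical : ∀ i b → Classical (lit i b)
lit-classical i true  = tt
lit-classical i false = tt

lit-clash : ∀ {i b c} → b ≢ c → Γ ⊢ lit i b → Γ ⊢ lit i c → Γ ⊢ ⊥f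
lit-clash {b = false} {false} b≢c d e = ⊥-elim (b≢c refl)
lit-clash {b = false} {true}  b≢c d e = contr (∧I e d)
lit-clash {b = true}  {false} b≢c d e = contr (∧I d e)
lit-clash {b = true}  {true}  b≢c d e = ⊥-elim (b≢c refl)

-- conjNE N v with NE replaced by the axiom p₀ ⊗ ¬p₀, so that it is classical.
conjᶜ : (N : List ℕ) → Vec Bool (length N) → Fm
conjᶜ []      []      = P 0 ⊗ ¬P 0
conjᶜ (i ∷ N) (b ∷ v) = lit i b ∧f conjᶜ N v

conjᶜ-classical : ∀ N v → Classical (conjᶜ N v)
conjᶜ-classical []      []      = tt , tt
conjᶜ-classical (i ∷ N) (b ∷ v) = lit-classical i b , conjᶜ-classical N v

conjNE⟹conjᶜ : ∀ N v → conjNE N v ⟹ conjᶜ N v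
conjNE⟹conjᶜ []      []      d = ax 0
conjNE⟹conjᶜ (i ∷ N) (b ∷ v) d = ∧I (∧E₁ d) (conjNE⟹conjᶜ N v (∧E₂ d))

conjNE⟹NE : ∀ N v → conjNE N v ⟹ NE
conjNE⟹NE []      []      d = d
conjNE⟹NE (i ∷ N) (b ∷ v) d = conjNE⟹NE N v (∧E₂ d)

conjNE⟹lit : ∀ N v {i} → i ∈ N → conjNE N v ⟹ lit i (toValuation N v i)
conjNE⟹lit (j ∷ N) (b ∷ v) {i} i∈ d with i ≟ j | i∈
... | yes refl | _         = ∧E₁ d
... | no  i≢j  | here i≡j  = ⊥-elim (i≢j i≡j)
... | no  _    | there i∈N = conjNE⟹lit N v i∈N (∧E₂ d)

conjᶜ-clash : ∀ N (v u : Vec Bool (length N)) → v ≢ u → (conjᶜ N v ∧f conjᶜ N u) ⟹ ⊥f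
conjᶜ-clash []      []      []      v≢u d = ⊥-elim (v≢u refl)
conjᶜ-clash (i ∷ N) (b ∷ v) (c ∷ u) bv≢cu d with b Bool.≟ c
... | no  b≢c  = lit-clash b≢c (∧E₁ (∧E₁ d)) (∧E₁ (∧E₂ d))
... | yes refl = conjᶜ-clash N v u (bv≢cu ∘ cong (b ∷_)) (∧I (∧E₂ (∧E₁ d)) (∧E₂ (∧E₂ d)))

rightOf : (m : Pos φ) → Pos (replaceAt φ m (ψ ∧f χ))
rightOf here   = ∧r here
rightOf (∧l m) = ∧l (rightOf m)
rightOf (∧r m) = ∧r (rightOf m)
rightOf (⊗l m) = ⊗l (rightOf m)
rightOf (⊗r m) = ⊗r (rightOf m)

subAt-rightOf : (m : Pos φ) → subAt (replaceAt φ m (ψ ∧f χ)) (rightOf m) ≡ χ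
subAt-rightOf here   = refl
subAt-rightOf (∧l m) = subAt-rightOf m
subAt-rightOf (∧r m) = subAt-rightOf m
subAt-rightOf (⊗l m) = subAt-rightOf m
subAt-rightOf (⊗r m) = subAt-rightOf m

replaceAt-rightOf : (m : Pos φ) → replaceAt (replaceAt φ m (ψ ∧f χ)) (rightOf m) θ ≡ replaceAt φ m (ψ ∧f θ)
replaceAt-rightOf here = refl
replaceAt-rightOf {_ ∧f φ} (∧l m) = cong (_∧f φ) (replaceAt-rightOf m)
replaceAt-rightOf {φ ∧f _} (∧r m) = cong (φ ∧f_) (replaceAt-rightOf m)
replaceAt-rightOf {_ ⊗ φ}  (⊗l m) = cong (_⊗ φ) (replaceAt-rightOf m)
replaceAt-rightOf {φ ⊗ _}  (⊗r m) = cong (φ ⊗_) (replaceAt-rightOf m)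

vars : Fm → List ℕ
vars (P i)    = i ∷ []
vars (¬P i)   = i ∷ []
vars ⊥f       = []
vars NE       = []
vars (φ ∧f ψ) = vars φ ++ vars ψ
vars (φ ⊗ ψ)  = vars φ ++ vars ψ

VarsIn : List ℕ → Fm → Set
VarsIn N (P i)    = i ∈ N
VarsIn N (¬P i)   = i ∈ N
VarsIn N ⊥f       = ⊤
VarsIn N NE       = ⊤
VarsIn N (φ ∧f ψ) = VarsIn N φ × VarsIn N ψ
VarsIn N (φ ⊗ ψ)  = VarsIn N φ × VarsIn N ψ

vars⊆⇒VarsIn : ∀ {N} χ → vars χ ⊆ N → VarsIn N χ
vars⊆⇒VarsIn (P i)    ⊆N = ⊆N (here refl)
vars⊆⇒VarsIn (¬P i)   ⊆N = ⊆N (here refl)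
vars⊆⇒VarsIn ⊥f       ⊆N = tt
vars⊆⇒VarsIn NE       ⊆N = tt
vars⊆⇒VarsIn (φ ∧f ψ) ⊆N = vars⊆⇒VarsIn φ (⊆N ∘ ∈-++⁺ˡ) , vars⊆⇒VarsIn ψ (⊆N ∘ ∈-++⁺ʳ (vars φ))
vars⊆⇒VarsIn (φ ⊗ ψ)  ⊆N = vars⊆⇒VarsIn φ (⊆N ∘ ∈-++⁺ˡ) , vars⊆⇒VarsIn ψ (⊆N ∘ ∈-++⁺ʳ (vars φ))

≢[]⇒∈ : ∀ {A : Set} (xs : List A) → xs ≢ [] → ∃ (_∈ xs)
≢[]⇒∈ []       xs≢[] = ⊥-elim (xs≢[] refl)
≢[]⇒∈ (x ∷ xs) _     = x , here refl

Filters : ∀ {A : Set} → (A → Set) → List A → List A → Set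
Filters Q xs ys = ys ⊆ xs × (∀ {x} → x ∈ ys → Q x) × (∀ {x} → x ∈ xs → Q x → x ∈ ys)

¬¬-filter : ∀ {A : Set} (Q : A → Set) (xs : List A) → ¬ ¬ ∃ (Filters Q xs)
¬¬-filter Q [] = pure ([] , (λ ()) , (λ ()) , (λ ()))
¬¬-filter Q (x ∷ xs) =
  ¬¬-filter Q xs >>= λ (ys , ys⊆xs , ys⊆Q , Q∩xs⊆ys) →
  ¬¬-excluded-middle >>= λ where
    (yes Qx) → pure {A = ∃ (Filters Q (x ∷ xs))}
      (x ∷ ys , ∷⁺ʳ x ys⊆xs ,
       (λ { (here refl) → Qx ; (there x∈ys) → ys⊆Q x∈ys }) ,
       (λ { (here refl) _ → here refl ; (there y∈xs) Qy → there (Q∩xs⊆ys y∈xs Qy) }))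
    (no ¬Qx) → pure {A = ∃ (Filters Q (x ∷ xs))}
      (ys , (λ y∈ys → there (ys⊆xs y∈ys)) , ys⊆Q ,
       (λ { (here refl) Qx → ⊥-elim (¬Qx Qx) ; (there y∈xs) Qy → Q∩xs⊆ys y∈xs Qy }))

module Teams (N : List ℕ) where

  V : Set
  V = Vec Bool (length N)

  _≟V_ : (u v : V) → Dec (u ≡ v)
  _≟V_ = Vec.≡-dec Bool._≟_

  open import Data.List.Membership.DecPropositional _≟V_ using (_∈?_)
  open import Data.List.Relation.Binary.Subset.DecPropositional _≟V_ using (_⊆?_)

  variable
    L L′ l l′ r : List V
    v : V

  data Tree : Set where
    empty : Tree
    leaf  : V → Tree
    node  : Tree → Tree → Tree

  leaves : Tree → List V
  leaves empty      = []
  leaves (leaf v)   = v ∷ []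
  leaves (node t u) = leaves t ++ leaves u

  -- Θ t is Θ* of the team leaves t, with the ⊗'s bracketed along t.
  Θ : Tree → Fm
  Θ empty      = ⊥f
  Θ (leaf v)   = conjNE N v
  Θ (node t u) = Θ t ⊗ Θ u

  Θᶜ : Tree → Fm
  Θᶜ empty      = ⊥f
  Θᶜ (leaf v)   = conjᶜ N v
  Θᶜ (node t u) = Θᶜ t ⊗ Θᶜ u

  fromList : List V → Tree
  fromList []           = empty
  fromList (v ∷ [])     = leaf v
  fromList (v ∷ w ∷ vs) = node (leaf v) (fromList (w ∷ vs))

  Θ-fromList : ∀ vs → Θ (fromList vs) ≡ bigO (map (conjNE N) vs)
  Θ-fromList []           = refl
  Θ-fromList (v ∷ [])     = refl
  Θ-fromList (v ∷ w ∷ vs) = cong (conjNE N v ⊗_) (Θ-fromList (w ∷ vs))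

  Θᶜ-classical : ∀ t → Classical (Θᶜ t)
  Θᶜ-classical empty      = tt
  Θᶜ-classical (leaf v)   = conjᶜ-classical N v
  Θᶜ-classical (node t u) = Θᶜ-classical t , Θᶜ-classical u

  Θ⟹Θᶜ : ∀ t → Θ t ⟹ Θᶜ t
  Θ⟹Θᶜ empty      d = d
  Θ⟹Θᶜ (leaf v)   d = conjNE⟹conjᶜ N v d
  Θ⟹Θᶜ (node t u) d = ⊗-map d (Θ⟹Θᶜ t) (Θ⟹Θᶜ u)

  Θ⟹⊥ : ∀ t → leaves t ≡ [] → Θ t ⟹ ⊥f
  Θ⟹⊥ empty      _  d = d
  Θ⟹⊥ (node t u) eq d =
    ⊗-elim tt d (Θ⟹⊥ t (++-conicalˡ (leaves t) _ eq)) (Θ⟹⊥ u (++-conicalʳ (leaves t) _ eq))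

  ConstantAt : ℕ → Bool → List V → Set
  ConstantAt i b = All (λ v → toValuation N v i ≡ b)

  Θ⟹lit : ∀ {i b} → i ∈ N → ∀ t → ConstantAt i b (leaves t) → Θ t ⟹ lit i b
  Θ⟹lit {i} {b} i∈N empty      _          d = ⊥-elimᶜ (lit-classical i b) d
  Θ⟹lit         i∈N (leaf v)   (refl ∷ []) d = conjNE⟹lit N v i∈N d
  Θ⟹lit {i} {b} i∈N (node t u) const      d =
    ⊗-elim (lit-classical i b) d (Θ⟹lit i∈N t (All.++⁻ˡ (leaves t) const))
                                 (Θ⟹lit i∈N u (All.++⁻ʳ (leaves t) const))

  Θᶜ-excludes : ∀ {s} t → s ∉ leaves t → (conjᶜ N s ∧f Θᶜ t) ⟹ ⊥f
  Θᶜ-excludes empty _ d = ∧E₂ d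
  Θᶜ-excludes {s} (leaf u) s∉ d with s ≟V u
  ... | yes refl = ⊥-elim (s∉ (here refl))
  ... | no  s≢u  = conjᶜ-clash N s u s≢u d
  Θᶜ-excludes {s} (node t u) s∉ d =
    ⊗-elim tt (distr (conjᶜ-classical N s) d)
      (Θᶜ-excludes t (s∉ ∘ ∈-++⁺ˡ)) (Θᶜ-excludes u (s∉ ∘ ∈-++⁺ʳ (leaves t)))

  -- Distribute α over the ⊗-tree Θ t and refute the branch at the leaf s; ⊥⁺ absorbs the other branches.
  Θ-refute-leaf : Classical α → ∀ t {s} → s ∈ leaves t → (α ∧f conjNE N s) ⟹ ⊥f → (α ∧f Θ t) ⟹ ⊥⁺
  Θ-refute-leaf c (leaf v)   (here refl) refute d = ∧I (refute d) (conjNE⟹NE N v (∧E₂ d))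
  Θ-refute-leaf c (node t u) s∈ refute d with ∈-++⁻ (leaves t) s∈
  ... | inj₁ s∈t = ⊗-absorbˡ (⊗-mapˡ (distr c d) (Θ-refute-leaf c t s∈t refute))
  ... | inj₂ s∈u = ⊗⊥NE (⊗-mapʳ (distr c d) (Θ-refute-leaf c u s∈u refute))

  Θ-⊈ : ∀ t u → ¬ leaves t ⊆ leaves u → Γ ⊢ Θ t → Γ ⊢ Θᶜ u → Γ ⊢ ⊥⁺
  Θ-⊈ t u t⊈u dt du =
    let s , s∈t , s∉u = find (¬All⇒Any¬ (_∈? leaves u) (leaves t) (t⊈u ∘ All.lookup))
    in Θ-refute-leaf (Θᶜ-classical u) t s∈t
         (λ d → Θᶜ-excludes u s∉u (∧I (conjNE⟹conjᶜ N s (∧E₂ d)) (∧E₁ d))) (∧I du dt)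

  -- The rule ΘE, derived for trees, with leaf sets in place of teams.
  Θ-agree : ∀ t u → Γ ⊢ Θ t → Γ ⊢ Θ u → Γ ⊢ ⊥⁺ ⊎ (leaves t ⊆ leaves u × leaves u ⊆ leaves t)
  Θ-agree t u dt du with leaves t ⊆? leaves u | leaves u ⊆? leaves t
  ... | yes t⊆u | yes u⊆t = inj₂ (t⊆u , u⊆t)
  ... | no  t⊈u | _       = inj₁ (Θ-⊈ t u t⊈u dt (Θ⟹Θᶜ u du))
  ... | _       | no  u⊈t = inj₁ (Θ-⊈ u t u⊈t du (Θ⟹Θᶜ t dt))

  -- Split L l r: each entry of L is sent to l, to r, or to both (teams may overlap in X = Y ∪ Z).
  data Split : List V → List V → List V → Set where
    []    : Split [] [] []
    left  : Split L l r → Split (v ∷ L) (v ∷ l) r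
    right : Split L l r → Split (v ∷ L) l (v ∷ r)
    both  : Split L l r → Split (v ∷ L) (v ∷ l) (v ∷ r)

  Split-⊆ˡ : Split L l r → l ⊆ L
  Split-⊆ˡ (left  sp) (here eq)  = here eq
  Split-⊆ˡ (left  sp) (there v∈) = there (Split-⊆ˡ sp v∈)
  Split-⊆ˡ (right sp) v∈         = there (Split-⊆ˡ sp v∈)
  Split-⊆ˡ (both  sp) (here eq)  = here eq
  Split-⊆ˡ (both  sp) (there v∈) = there (Split-⊆ˡ sp v∈)

  Split-⊆ʳ : Split L l r → r ⊆ L
  Split-⊆ʳ (left  sp) v∈         = there (Split-⊆ʳ sp v∈)
  Split-⊆ʳ (right sp) (here eq)  = here eq
  Split-⊆ʳ (right sp) (there v∈) = there (Split-⊆ʳ sp v∈)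
  Split-⊆ʳ (both  sp) (here eq)  = here eq
  Split-⊆ʳ (both  sp) (there v∈) = there (Split-⊆ʳ sp v∈)

  _⊆_∪_ : List V → List V → List V → Set
  L ⊆ l ∪ r = ∀ {v} → v ∈ L → v ∈ l ⊎ v ∈ r

  Split-cover : Split L l r → L ⊆ l ∪ r
  Split-cover (left  sp) (here refl) = inj₁ (here refl)
  Split-cover (right sp) (here refl) = inj₂ (here refl)
  Split-cover (both  sp) (here refl) = inj₁ (here refl)
  Split-cover (left  sp) (there v∈)  = Sum.map₁ there (Split-cover sp v∈)
  Split-cover (right sp) (there v∈)  = Sum.map₂ there (Split-cover sp v∈)
  Split-cover (both  sp) (there v∈)  = Sum.map there there (Split-cover sp v∈)

  split-++ : ∀ l {r} → Split (l ++ r) l r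
  split-++ []      {[]}    = []
  split-++ []      {v ∷ r} = right (split-++ [])
  split-++ (v ∷ l)         = left (split-++ l)

  Split-++⁻ : ∀ L₁ {L₂} → Split (L₁ ++ L₂) l r →
              ∃₂ λ l₁ r₁ → ∃₂ λ l₂ r₂ → Split L₁ l₁ r₁ × Split L₂ l₂ r₂ × l ≡ l₁ ++ l₂ × r ≡ r₁ ++ r₂
  Split-++⁻ [] sp = [] , [] , _ , _ , [] , sp , refl , refl
  Split-++⁻ (v ∷ L₁) (left sp) with Split-++⁻ L₁ sp
  ... | l₁ , r₁ , l₂ , r₂ , sp₁ , sp₂ , refl , refl = v ∷ l₁ , r₁ , l₂ , r₂ , left sp₁ , sp₂ , refl , refl
  Split-++⁻ (v ∷ L₁) (right sp) with Split-++⁻ L₁ sp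
  ... | l₁ , r₁ , l₂ , r₂ , sp₁ , sp₂ , refl , refl = l₁ , v ∷ r₁ , l₂ , r₂ , right sp₁ , sp₂ , refl , refl
  Split-++⁻ (v ∷ L₁) (both sp) with Split-++⁻ L₁ sp
  ... | l₁ , r₁ , l₂ , r₂ , sp₁ , sp₂ , refl , refl =
    v ∷ l₁ , v ∷ r₁ , l₂ , r₂ , both sp₁ , sp₂ , refl , refl

  any-split? : ∀ L (R : List V → List V → Set) → (∀ l r → Dec (R l r)) →
               Dec (∃₂ λ l r → Split L l r × R l r)
  any-split? [] R R? = map′ (λ Rlr → [] , [] , [] , Rlr) (λ { (_ , _ , [] , Rlr) → Rlr }) (R? [] [])
  any-split? (v ∷ L) R R? =
    map′ to from (any-split? L R′ λ l r → R? (v ∷ l) r ⊎-dec R? l (v ∷ r) ⊎-dec R? (v ∷ l) (v ∷ r))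
    where
    R′ : List V → List V → Set
    R′ l r = R (v ∷ l) r ⊎ R l (v ∷ r) ⊎ R (v ∷ l) (v ∷ r)
    to : (∃₂ λ l r → Split L l r × R′ l r) → ∃₂ λ l r → Split (v ∷ L) l r × R l r
    to (_ , _ , sp , inj₁ Rlr)        = _ , _ , left sp , Rlr
    to (_ , _ , sp , inj₂ (inj₁ Rlr)) = _ , _ , right sp , Rlr
    to (_ , _ , sp , inj₂ (inj₂ Rlr)) = _ , _ , both sp , Rlr
    from : (∃₂ λ l r → Split (v ∷ L) l r × R l r) → ∃₂ λ l r → Split L l r × R′ l r
    from (_ , _ , left  sp , Rlr) = _ , _ , sp , inj₁ Rlr
    from (_ , _ , right sp , Rlr) = _ , _ , sp , inj₂ (inj₁ Rlr)
    from (_ , _ , both  sp , Rlr) = _ , _ , sp , inj₂ (inj₂ Rlr)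

  _≐_∩_ : List V → List V → List V → Set
  l′ ≐ l ∩ L = l′ ⊆ l × (∀ {v} → v ∈ L → v ∈ l → v ∈ l′)

  ≐∩-keep : v ∈ l → l′ ≐ l ∩ L → (v ∷ l′) ≐ l ∩ (v ∷ L)
  ≐∩-keep v∈l (l′⊆l , ∩⊆l′) =
    ∈-∷⁺ʳ v∈l l′⊆l , λ { (here refl) _ → here refl ; (there w∈L) w∈l → there (∩⊆l′ w∈L w∈l) }

  ≐∩-skip : v ∉ l → l′ ≐ l ∩ L → l′ ≐ l ∩ (v ∷ L)
  ≐∩-skip v∉l (l′⊆l , ∩⊆l′) =
    l′⊆l , λ { (here refl) v∈l → ⊥-elim (v∉l v∈l) ; (there w∈L) w∈l → ∩⊆l′ w∈L w∈l }

  split-along : ∀ L → L ⊆ l ∪ r → ∃₂ λ l′ r′ → Split L l′ r′ × l′ ≐ l ∩ L × r′ ≐ r ∩ L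
  split-along [] _ = [] , [] , [] , ∅ , ∅
    where
    ∅ : ∀ {l} → [] ≐ l ∩ []
    ∅ = (λ ()) , λ ()
  split-along {l} {r} (v ∷ L) L⊆l∪r
    with split-along L (λ w∈L → L⊆l∪r (there w∈L)) | v ∈? l | v ∈? r
  ... | _ , _ , sp , ∩l , ∩r | yes v∈l | yes v∈r = _ , _ , both sp  , ≐∩-keep v∈l ∩l , ≐∩-keep v∈r ∩r
  ... | _ , _ , sp , ∩l , ∩r | yes v∈l | no  v∉r = _ , _ , left sp  , ≐∩-keep v∈l ∩l , ≐∩-skip v∉r ∩r
  ... | _ , _ , sp , ∩l , ∩r | no  v∉l | yes v∈r = _ , _ , right sp , ≐∩-skip v∉l ∩l , ≐∩-keep v∈r ∩r
  ... | _ | no v∉l | no v∉r = ⊥-elim (Sum.[ v∉l , v∉r ] (L⊆l∪r (here refl)))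

  -- Team semantics of a finite team on N, listed with possible repetitions.
  infix 4 _⊨ᴸ_ _⊨ᴸ?_
  _⊨ᴸ_ : List V → Fm → Set
  L ⊨ᴸ P i    = ConstantAt i true L
  L ⊨ᴸ ¬P i   = ConstantAt i false L
  L ⊨ᴸ ⊥f     = L ≡ []
  L ⊨ᴸ NE     = ∃ (_∈ L)
  L ⊨ᴸ φ ∧f ψ = L ⊨ᴸ φ × L ⊨ᴸ ψ
  L ⊨ᴸ φ ⊗ ψ  = ∃₂ λ l r → Split L l r × l ⊨ᴸ φ × r ⊨ᴸ ψ

  _⊨ᴸ?_ : ∀ L χ → Dec (L ⊨ᴸ χ)
  L       ⊨ᴸ? P i    = All.all? (λ v → toValuation N v i Bool.≟ true) L
  L       ⊨ᴸ? ¬P i   = All.all? (λ v → toValuation N v i Bool.≟ false) L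
  []      ⊨ᴸ? ⊥f     = yes refl
  (_ ∷ _) ⊨ᴸ? ⊥f     = no λ ()
  []      ⊨ᴸ? NE     = no λ { (_ , ()) }
  (v ∷ _) ⊨ᴸ? NE     = yes (v , here refl)
  L       ⊨ᴸ? φ ∧f ψ = (L ⊨ᴸ? φ) ×-dec (L ⊨ᴸ? ψ)
  L       ⊨ᴸ? φ ⊗ ψ  = any-split? L _ λ l r → (l ⊨ᴸ? φ) ×-dec (r ⊨ᴸ? ψ)

  ⊨ᴸ-resp : ∀ χ → L ⊆ L′ → L′ ⊆ L → L ⊨ᴸ χ → L′ ⊨ᴸ χ
  ⊨ᴸ-resp (P i)    _     L′⊆L const       = All.tabulate (All.lookup const ∘ L′⊆L)
  ⊨ᴸ-resp (¬P i)   _     L′⊆L const       = All.tabulate (All.lookup const ∘ L′⊆L)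
  ⊨ᴸ-resp ⊥f       _     L′⊆L refl        = ⊆[]⇒≡[] L′⊆L
  ⊨ᴸ-resp NE       L⊆L′ _    (v , v∈L)   = v , L⊆L′ v∈L
  ⊨ᴸ-resp (φ ∧f ψ) L⊆L′ L′⊆L (⊨φ , ⊨ψ)   = ⊨ᴸ-resp φ L⊆L′ L′⊆L ⊨φ , ⊨ᴸ-resp ψ L⊆L′ L′⊆L ⊨ψ
  ⊨ᴸ-resp (φ ⊗ ψ) L⊆L′ L′⊆L (l , r , sp , ⊨φ , ⊨ψ)
    with split-along _ (Split-cover sp ∘ L′⊆L)
  ... | l′ , r′ , sp′ , (l′⊆l , l∩L′⊆l′) , (r′⊆r , r∩L′⊆r′) =
    l′ , r′ , sp′ ,
    ⊨ᴸ-resp φ (λ v∈l → l∩L′⊆l′ (L⊆L′ (Split-⊆ˡ sp v∈l)) v∈l) l′⊆l ⊨φ ,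
    ⊨ᴸ-resp ψ (λ v∈r → r∩L′⊆r′ (L⊆L′ (Split-⊆ʳ sp v∈r)) v∈r) r′⊆r ⊨ψ

  ⊨ᴸ-⊗-intro : l ⊆ L → r ⊆ L → L ⊆ l ∪ r → l ⊨ᴸ φ → r ⊨ᴸ ψ → L ⊨ᴸ φ ⊗ ψ
  ⊨ᴸ-⊗-intro {l} {L} {r} {φ} {ψ} l⊆L r⊆L L⊆l∪r ⊨φ ⊨ψ =
    ⊨ᴸ-resp (φ ⊗ ψ) (Sum.[ l⊆L , r⊆L ] ∘ ∈-++⁻ l) (Sum.[ ∈-++⁺ˡ , ∈-++⁺ʳ l ] ∘ L⊆l∪r)
      (l , r , split-++ l , ⊨φ , ⊨ψ)

  Θ-split : ∀ t → Split (leaves t) l r → ∃₂ λ u w → leaves u ≡ l × leaves w ≡ r × (Θ t ⟹ Θ u ⊗ Θ w)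
  Θ-split empty    []          = empty , empty , refl , refl , ⊗dup
  Θ-split (leaf v) (left  [])  = leaf v , empty , refl , refl , ⊗I tt
  Θ-split (leaf v) (right [])  = empty , leaf v , refl , refl , ⊗Comm ∘ ⊗I tt
  Θ-split (leaf v) (both  [])  = leaf v , leaf v , refl , refl , ⊗dup
  Θ-split (node t u) sp with Split-++⁻ (leaves t) sp
  ... | _ , _ , _ , _ , spt , spu , refl , refl with Θ-split t spt | Θ-split u spu
  ... | tl , tr , refl , refl , t⟹ | ul , ur , refl , refl , u⟹ =
    node tl ul , node tr ur , refl , refl , λ d → ⊗-interchange (⊗-map d t⟹ u⟹)

  Θ-derives : ∀ χ → VarsIn N χ → ∀ t → leaves t ⊨ᴸ χ → Θ t ⟹ χ
  Θ-derives (P i)    i∈N t ⊨χ = Θ⟹lit i∈N t ⊨χ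
  Θ-derives (¬P i)   i∈N t ⊨χ = Θ⟹lit i∈N t ⊨χ
  Θ-derives ⊥f       _   t ⊨χ = Θ⟹⊥ t ⊨χ
  -- SE₂ splits Θ t into an empty part, which the leaf v refutes, and a nonempty part.
  Θ-derives NE       _   t (v , v∈t) d =
    SE₂ here d (exFalso (Θ-refute-leaf tt t v∈t ∧E₁ (∧I (∧E₂ hyp) (∧E₁ hyp)))) (∧E₂ hyp)
  Θ-derives (φ ∧f ψ) (vφ , vψ) t (⊨φ , ⊨ψ) d = ∧I (Θ-derives φ vφ t ⊨φ d) (Θ-derives ψ vψ t ⊨ψ d)
  Θ-derives (φ ⊗ ψ)  (vφ , vψ) t (_ , _ , sp , ⊨φ , ⊨ψ) d with Θ-split t sp
  ... | u , w , refl , refl , t⟹u⊗w = ⊗-map (t⟹u⊗w d) (Θ-derives φ vφ u ⊨φ) (Θ-derives ψ vψ w ⊨ψ)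

  Θ-refutes-lit : ∀ {i b} → i ∈ N → ∀ t → ¬ ConstantAt i b (leaves t) → Γ ⊢ lit i b → Γ ⊢ Θ t → Γ ⊢ ⊥⁺
  Θ-refutes-lit {i = i} {b} i∈N t ¬const d e =
    let v , v∈t , vi≢b = find (¬All⇒Any¬ (λ v → toValuation N v i Bool.≟ b) (leaves t) ¬const)
    in Θ-refute-leaf (lit-classical i b) t v∈t
         (λ d′ → lit-clash (vi≢b ∘ sym) (∧E₁ d′) (conjNE⟹lit N v i∈N (∧E₂ d′))) (∧I d e)

  Image : Team → V → Set
  Image Y v = ∃ λ s → Y s × restrict N s ≡ v

  Represents : Team → List V → Set
  Represents Y L = (∀ s → Y s → restrict N s ∈ L) × (∀ {v} → v ∈ L → Image Y v)

  sound-lit : ∀ {Y i b} → i ∈ N → Represents Y L → ConstantAt i b L → ∀ s → Y s → s i ≡ b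
  sound-lit i∈N (Y⊆L , _) const s Ys =
    trans (sym (toValuation-restrict N s i∈N)) (All.lookup const (Y⊆L s Ys))

  complete-lit : ∀ {Y i b} → i ∈ N → Represents Y L → (∀ s → Y s → s i ≡ b) → ConstantAt i b L
  complete-lit i∈N (_ , L⊆Y) const =
    All.tabulate λ v∈L → case L⊆Y v∈L of λ where
      (s , Ys , refl) → trans (toValuation-restrict N s i∈N) (const s Ys)

  sound : ∀ {Y} χ → VarsIn N χ → Represents Y L → L ⊨ᴸ χ → Y ⊨ₜ χ
  sound (P i)    i∈N rep ⊨χ = lift (sound-lit i∈N rep ⊨χ)
  sound (¬P i)   i∈N rep ⊨χ = lift (sound-lit i∈N rep ⊨χ)
  sound ⊥f       _   (Y⊆L , _) refl = lift λ s Ys → case Y⊆L s Ys of λ ()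
  sound NE       _   (_ , L⊆Y) (v , v∈L) = let s , Ys , _ = L⊆Y v∈L in lift (s , Ys)
  sound (φ ∧f ψ) (vφ , vψ) rep (⊨φ , ⊨ψ) = sound φ vφ rep ⊨φ , sound ψ vψ rep ⊨ψ
  sound {L} {Y} (φ ⊗ ψ) (vφ , vψ) (Y⊆L , L⊆Y) (l , r , sp , ⊨φ , ⊨ψ) =
    part l , part r , lift ((λ _ → proj₁) , (λ _ → proj₁) , cover) ,
    sound φ vφ (represents-part (Split-⊆ˡ sp)) ⊨φ , sound ψ vψ (represents-part (Split-⊆ʳ sp)) ⊨ψ
    where
    part : List V → Team
    part l s = Y s × restrict N s ∈ l
    represents-part : ∀ {l} → l ⊆ L → Represents (part l) l
    represents-part l⊆L = (λ _ → proj₂) , λ v∈l →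
      let s , Ys , eq = L⊆Y (l⊆L v∈l) in s , (Ys , subst (_∈ _) (sym eq) v∈l) , eq
    cover : ∀ s → Y s → part l s ⊎ part r s
    cover s Ys = Sum.map (Ys ,_) (Ys ,_) (Split-cover sp (Y⊆L s Ys))

  -- Only ¬¬: splitting L along a decomposition of Y uses excluded middle; ⊨ᴸ is decidable anyway.
  complete : ∀ {Y} χ → VarsIn N χ → Represents Y L → Y ⊨ₜ χ → ¬ ¬ L ⊨ᴸ χ
  complete (P i)  i∈N rep (lift ⊨χ) = pure (complete-lit i∈N rep ⊨χ)
  complete (¬P i) i∈N rep (lift ⊨χ) = pure (complete-lit i∈N rep ⊨χ)
  complete {[]}    ⊥f _ _         _         = pure refl
  complete {_ ∷ _} ⊥f _ (_ , L⊆Y) (lift ⊨χ) = let s , Ys , _ = L⊆Y (here refl) in ⊥-elim (⊨χ s Ys)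
  complete NE _ (Y⊆L , _) (lift (s , Ys)) = pure (restrict N s , Y⊆L s Ys)
  complete (φ ∧f ψ) (vφ , vψ) rep (⊨φ , ⊨ψ) =
    complete φ vφ rep ⊨φ >>= λ L⊨φ → complete ψ vψ rep ⊨ψ >>= λ L⊨ψ → pure (L⊨φ , L⊨ψ)
  complete {L} {Y} (φ ⊗ ψ) (vφ , vψ) (Y⊆L , L⊆Y) (A , B , lift (A⊆Y , B⊆Y , Y⊆A∪B) , ⊨φ , ⊨ψ) =
    ¬¬-filter (Image A) L >>= λ (la , la⊆L , la⊆A , A∩L⊆la) →
    ¬¬-filter (Image B) L >>= λ (lb , lb⊆L , lb⊆B , B∩L⊆lb) →
    complete φ vφ (represents A⊆Y la⊆A A∩L⊆la) ⊨φ >>= λ la⊨φ →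
    complete ψ vψ (represents B⊆Y lb⊆B B∩L⊆lb) ⊨ψ >>= λ lb⊨ψ →
    pure (⊨ᴸ-⊗-intro la⊆L lb⊆L
            (λ v∈L → Sum.map (A∩L⊆la v∈L) (B∩L⊆lb v∈L) (image-cover v∈L)) la⊨φ lb⊨ψ)
    where
    represents : ∀ {Z l} → Z ⊆T Y → (∀ {v} → v ∈ l → Image Z v) → (∀ {v} → v ∈ L → Image Z v → v ∈ l) →
                 Represents Z l
    represents Z⊆Y l⊆Z Z∩L⊆l = (λ s Zs → Z∩L⊆l (Y⊆L s (Z⊆Y s Zs)) (s , Zs , refl)) , l⊆Z
    image-cover : ∀ {v} → v ∈ L → Image A v ⊎ Image B v
    image-cover v∈L with L⊆Y v∈L
    ... | s , Ys , eq = Sum.map (λ As → s , As , eq) (λ Bs → s , Bs , eq) (Y⊆A∪B s Ys)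

  module _ (N-unique : Unique N) where

    -- SE₂ at m leaves the case χ ∧ ⊥ (the tree empty) and the case χ ∧ NE, on whose NE SE₁
    -- ranges over the nonempty teams on N.
    Θ-cases : ∀ φ (m : Pos φ) → Γ ⊢ φ → (∀ t → (replaceAt φ m (subAt φ m ∧f Θ t) ∷ Γ) ⊢ θ) → Γ ⊢ θ
    Θ-cases {Γ} {θ} φ m d case =
      SE₂ m d (case empty)
        (SE₁ N N-unique (rightOf m) (subAt-rightOf m) hyp λ Y _ →
          subst (λ β → (β ∷ _) ⊢ θ) (sym (Θ*-as-tree Y)) (weaken skip-second (case (fromList (members Y)))))
      where
      members : TeamOn N → List V
      members Y = filter (λ v → Y v Bool.≟ true) (allVals (length N))
      Θ*-as-tree : ∀ Y → replaceAt (replaceAt φ m (subAt φ m ∧f NE)) (rightOf m) (Θ* N Y)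
                         ≡ replaceAt φ m (subAt φ m ∧f Θ (fromList (members Y)))
      Θ*-as-tree Y = trans (replaceAt-rightOf m)
                           (cong (λ β → replaceAt φ m (subAt φ m ∧f β)) (sym (Θ-fromList (members Y))))
      skip-second : ∀ {β γ} → (β ∷ Γ) ⊆L (β ∷ γ ∷ Γ)
      skip-second (here eq)  = here eq
      skip-second (there φ∈) = there (there φ∈)

    Θ-refutes : ∀ χ → VarsIn N χ → ∀ t → ¬ leaves t ⊨ᴸ χ → Γ ⊢ χ → Γ ⊢ Θ t → Γ ⊢ ⊥⁺
    Θ-refutes (P i)  i∈N t ¬⊨χ = Θ-refutes-lit i∈N t ¬⊨χ
    Θ-refutes (¬P i) i∈N t ¬⊨χ = Θ-refutes-lit i∈N t ¬⊨χ
    Θ-refutes ⊥f _ t ¬⊨χ d e =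
      let _ , v∈t = ≢[]⇒∈ (leaves t) ¬⊨χ in Θ-refute-leaf tt t v∈t ∧E₁ (∧I d e)
    Θ-refutes NE _ t ¬⊨χ d e = ∧I (Θ⟹⊥ t (⊆[]⇒≡[] λ v∈t → ⊥-elim (¬⊨χ (_ , v∈t))) e) d
    Θ-refutes (φ ∧f ψ) (vφ , vψ) t ¬⊨χ d e with leaves t ⊨ᴸ? φ
    ... | yes ⊨φ = Θ-refutes ψ vψ t (¬⊨χ ∘ (⊨φ ,_)) (∧E₂ d) e
    ... | no ¬⊨φ = Θ-refutes φ vφ t ¬⊨φ (∧E₁ d) e
    -- Split both disjuncts by Θ-cases into Θ u and Θ w. Unless one side is refuted recursively,
    -- Θ-agree forces leaves t to be covered by leaves u and leaves w, so that t would satisfy φ ⊗ ψ.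
    Θ-refutes (φ ⊗ ψ) (vφ , vψ) t ¬⊨χ d e =
      Θ-cases (φ ⊗ ψ) (⊗l here) d λ u →
      Θ-cases ((φ ∧f Θ u) ⊗ ψ) (⊗r here) hyp λ w →
      refute u w hyp (weaken (there ∘ there) e)
      where
      refute : ∀ u w → Δ ⊢ (φ ∧f Θ u) ⊗ (ψ ∧f Θ w) → Δ ⊢ Θ t → Δ ⊢ ⊥⁺
      refute u w d e with leaves u ⊨ᴸ? φ | leaves w ⊨ᴸ? ψ
      ... | no ¬⊨φ | _      = ⊗-absorbˡ (⊗-mapˡ d λ d′ → Θ-refutes φ vφ u ¬⊨φ (∧E₁ d′) (∧E₂ d′))
      ... | yes _  | no ¬⊨ψ = ⊗⊥NE (⊗-mapʳ d λ d′ → Θ-refutes ψ vψ w ¬⊨ψ (∧E₁ d′) (∧E₂ d′))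
      ... | yes ⊨φ | yes ⊨ψ with Θ-agree (node u w) t (⊗-map d ∧E₂ ∧E₂) e
      ...   | inj₁ ⊢⊥⁺         = ⊢⊥⁺
      ...   | inj₂ (uw⊆t , t⊆uw) = ⊥-elim (¬⊨χ (⊨ᴸ-⊗-intro (uw⊆t ∘ ∈-++⁺ˡ) (uw⊆t ∘ ∈-++⁺ʳ (leaves u))
                                                           (∈-++⁻ (leaves u) ∘ t⊆uw) ⊨φ ⊨ψ))

    ⊨ᴸ-transfer : VarsIn N φ → VarsIn N ψ → φ ⊨ ψ → L ⊨ᴸ φ → L ⊨ᴸ ψ
    ⊨ᴸ-transfer {φ} {ψ} {L} vφ vψ φ⊨ψ ⊨φ =
      decidable-stable (L ⊨ᴸ? ψ) (complete ψ vψ rep (φ⊨ψ X (sound φ vφ rep ⊨φ)))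
      where
      X : Team
      X s = restrict N s ∈ L
      rep : Represents X L
      rep = (λ _ → id) , λ {v} v∈L →
        toValuation N v , subst (_∈ L) (sym (restrict-toValuation N-unique v)) v∈L ,
        restrict-toValuation N-unique v

    ⊨⇒⊢ : VarsIn N φ → VarsIn N ψ → φ ⊨ ψ → (φ ∷ []) ⊢ ψ
    ⊨⇒⊢ {φ} {ψ} vφ vψ φ⊨ψ = Θ-cases φ here hyp case
      where
      case : ∀ t → (φ ∧f Θ t ∷ φ ∷ []) ⊢ ψ
      case t with leaves t ⊨ᴸ? φ
      ... | yes ⊨φ  = Θ-derives ψ vψ t (⊨ᴸ-transfer vφ vψ φ⊨ψ ⊨φ) (∧E₂ hyp)
      ... | no  ¬⊨φ = exFalso (Θ-refutes φ vφ t ¬⊨φ (∧E₁ hyp) (∧E₂ hyp))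

theorem5p16 : (φ ψ : Fm) → φ ⊨ ψ → (φ ∷ []) ⊢ ψ
theorem5p16 φ ψ =
  Teams.⊨⇒⊢ N (deduplicate-! (vars φ ++ vars ψ))
    (vars⊆⇒VarsIn φ (∈-deduplicate⁺ _≟_ ∘ ∈-++⁺ˡ))
    (vars⊆⇒VarsIn ψ (∈-deduplicate⁺ _≟_ ∘ ∈-++⁺ʳ (vars φ)))
  where
  N : List ℕ
  N = deduplicate _≟_ (vars φ ++ vars ψ)
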